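{- For every integer $n\ge 2$, the pentagonal snake $S_{5,n}$ is neighborhood-prime.
   Context: A neighborhood-prime labeling of a simple graph $G$ with $N$ vertices is a bijection $f:V(G)\to\{1,\ldots,N\}$ such that for every vertex $v$ with $\deg(v)>1$, $\gcd\{f(u):u\in N(v)\}=1$, where $N(v)$ is the neighborhood of $v$; a graph admitting one is neighborhood-prime. The pentagonal snake $S_{5,n}$ is obtained from a path $u_1,\ldots,u_n$ by adding, for each $i=1,\ldots,n-1$, three new vertices $v_i,w_i,x_i$ and the edges forming the path $u_i,v_i,w_i,x_i,u_{i+1}$ (so each consecutive pair $u_i,u_{i+1}$ lies on a 5-cycle). -}

module Defs where

open import Level using (0ℓ)
open import Data.Nat using (ℕ; suc; _+_; _*_; _∸_; _<_; _≤_)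
open import Data.Nat.Divisibility using (_∣_)
open import Data.Fin using (Fin; toℕ)
open import Data.Product using (Σ; _×_; ∃₂)
open import Data.Sum using (_⊎_)
open import Data.Empty using (⊥)
open import Relation.Nullary using (¬_)
open import Relation.Binary.PropositionalEquality using (_≡_; _≢_)
open import Function.Bundles using (_⤖_; Bijection)

record Graph : Set₁ where
  field
    N     : ℕ
    Adj   : Fin N → Fin N → Set
    symmetric : ∀ {a b} → Adj a b → Adj b a
    loopless : ∀ {a} → ¬ Adj a a
open Graph public

DegGt1 : (G : Graph) → Fin (N G) → Set
DegGt1 G v = ∃₂ λ a b → a ≢ b × Adj G v a × Adj G v b

NbhdGcdOne : (G : Graph) → (Fin (N G) → ℕ) → Fin (N G) → Set
NbhdGcdOne G ℓ v = ∀ d → (∀ u → Adj G v u → d ∣ ℓ u) → d ≡ 1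

-- A labeling is a bijection f : V → Fin N; the label of v is 1 + toℕ (f v),
-- so labels range bijectively over {1, …, N}.
label : ∀ {N} → (Fin N ⤖ Fin N) → Fin N → ℕ
label f v = suc (toℕ (Bijection.to f v))

IsNeighborhoodPrimeLabeling : (G : Graph) → (Fin (N G) ⤖ Fin (N G)) → Set
IsNeighborhoodPrimeLabeling G f = ∀ v → DegGt1 G v → NbhdGcdOne G (label f) v

NeighborhoodPrime : Graph → Set
NeighborhoodPrime G = Σ (Fin (N G) ⤖ Fin (N G)) (IsNeighborhoodPrimeLabeling G)

-- Vertex numbering (0-based, on ℕ):
--   u_{i+1} ↦ 4i,  v_{i+1} ↦ 4i+1,  w_{i+1} ↦ 4i+2,  x_{i+1} ↦ 4i+3,
-- for i < n (u) resp. i < n-1 (v, w, x); total 4n-3 vertices, numbered 0 … 4n-4.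
-- Directed edge list (each undirected edge listed once):
data SnakeEdge (n : ℕ) : ℕ → ℕ → Set where
  u-u : ∀ i → suc i < n → SnakeEdge n (4 * i)     (4 * suc i)
  u-v : ∀ i → suc i < n → SnakeEdge n (4 * i)     (4 * i + 1)
  v-w : ∀ i → suc i < n → SnakeEdge n (4 * i + 1) (4 * i + 2)
  w-x : ∀ i → suc i < n → SnakeEdge n (4 * i + 2) (4 * i + 3)
  x-u : ∀ i → suc i < n → SnakeEdge n (4 * i + 3) (4 * suc i)

SnakeAdj : (n : ℕ) → Fin (4 * n ∸ 3) → Fin (4 * n ∸ 3) → Set
SnakeAdj n a b = SnakeEdge n (toℕ a) (toℕ b) ⊎ SnakeEdge n (toℕ b) (toℕ a)

private
  open import Data.Sum using (inj₁; inj₂; [_,_])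
  open import Data.Nat.Properties using (m≤n⇒m≤1+n; n≮n; +-comm; *-suc; m<n+m; ≤-refl; +-monoʳ-<)
  open import Relation.Binary.PropositionalEquality using (sym; subst; refl)

  lt : ∀ {n a b} → SnakeEdge n a b → a < b
  lt (u-u i _) = subst (4 * i <_) (sym (*-suc 4 i)) (lemma4 i)
    where
      lemma4 : ∀ i → 4 * i < 4 + 4 * i
      lemma4 i = m<n+m (4 * i) {4} (Data.Nat.s≤s Data.Nat.z≤n)
  lt (u-v i _) = subst (_< 4 * i + 1) (Data.Nat.Properties.+-identityʳ (4 * i)) (+-monoʳ-< (4 * i) (Data.Nat.s≤s Data.Nat.z≤n))
  lt (v-w i _) = +-monoʳ-< (4 * i) (Data.Nat.s≤s (Data.Nat.s≤s Data.Nat.z≤n))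
  lt (w-x i _) = +-monoʳ-< (4 * i) (Data.Nat.s≤s (Data.Nat.s≤s (Data.Nat.s≤s Data.Nat.z≤n)))
  lt (x-u i _) = subst (4 * i + 3 <_) (trans' i) (+-monoʳ-< (4 * i) ≤-refl)
    where
      open import Relation.Binary.PropositionalEquality using (trans)
      trans' : ∀ i → 4 * i + 4 ≡ 4 * suc i
      trans' i = trans (+-comm (4 * i) 4) (sym (*-suc 4 i))

  noLoop : ∀ {n a} → ¬ SnakeEdge n a a
  noLoop e = n≮n _ (lt e)

pentagonalSnake : ℕ → Graph
pentagonalSnake n = record
  { N = 4 * n ∸ 3
  ; Adj = SnakeAdj n
  ; symmetric = [ inj₂ , inj₁ ]
  ; loopless = [ noLoop , noLoop ]
  }

module Submission where

-- Read u₁ v₁ w₁ x₁ u₂ … x_{n-1} uₙ as the indices 0 … N−1, N = 4n − 3. Consecutive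
-- indices are adjacent, so this is a Hamiltonian path of S_{5,n}. Since N is odd,
-- 2 is invertible modulo N, and vertex k receives the label 1 + σ(k), where σ(k) < N
-- solves 2σ(k) ≡ k + 2 (mod N); this is the labelling of the paper. Going two steps
-- along the path raises σ by one modulo N, so every inner vertex has two neighbours
-- whose labels are consecutive or include 1. At the ends, uₙ is adjacent to x_{n-1},
-- labelled 1, and u₁ is adjacent to u₂ and v₁, labelled 4 and 2n + 1.

open import Defs
open import Data.Nat
open import Data.Nat.Properties
open import Data.Nat.DivMod
open import Data.Nat.Divisibility
open import Data.Nat.Coprimality using (Coprime; 1-coprimeTo) renaming (sym to Coprime-sym)
open import Data.Nat.Tactic.RingSolver using (solve-∀)
open import Data.Fin using (Fin; toℕ; fromℕ<)
open import Data.Fin.Properties using (toℕ-fromℕ<; toℕ-injective; toℕ<n)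
open import Data.Product using (_,_)
open import Data.Sum using (_⊎_; inj₁; inj₂)
open import Function.Base using (_∘_)
open import Function.Bundles using (_⤖_; Bijection; mk↔ₛ′)
open import Function.Properties.Inverse using (↔⇒⤖)
open import Relation.Binary.PropositionalEquality
open ≡-Reasoning

coprime-suc : ∀ n → Coprime n (suc n)
coprime-suc n {d} (d∣n , d∣1+n) =
  ∣1⇒≡1 (∣m+n∣m⇒∣n (subst (d ∣_) (+-comm 1 n) d∣1+n) d∣n)

odd-coprime-4 : ∀ k → Coprime (1 + 2 * k) 4
odd-coprime-4 k {d} (d∣1+2k , d∣4) = coprime-suc (2 * k) (∣m⇒∣m*n k d∣2 , d∣1+2k)
  where
  2[1+2k]≡4k+2 : ∀ k → 2 * (1 + 2 * k) ≡ 4 * k + 2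
  2[1+2k]≡4k+2 = solve-∀

  d∣2 : d ∣ 2
  d∣2 = ∣m+n∣m⇒∣n (subst (d ∣_) (2[1+2k]≡4k+2 k) (∣n⇒∣m*n 2 d∣1+2k)) (∣m⇒∣m*n k d∣4)

module _ {N : ℕ} .{{_ : NonZero N}} where

  %-cong-+ʳ : ∀ m {n n′} → n % N ≡ n′ % N → (m + n) % N ≡ (m + n′) % N
  %-cong-+ʳ m {n} {n′} eq = begin
    (m + n) % N           ≡⟨ %-distribˡ-+ m n N ⟩
    (m % N + n % N) % N   ≡⟨ cong (λ r → (m % N + r) % N) eq ⟩
    (m % N + n′ % N) % N  ≡⟨ %-distribˡ-+ m n′ N ⟨
    (m + n′) % N          ∎

  %-cong-*ʳ : ∀ m {n n′} → n % N ≡ n′ % N → (m * n) % N ≡ (m * n′) % N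
  %-cong-*ʳ m {n} {n′} eq = begin
    (m * n) % N            ≡⟨ %-distribˡ-* m n N ⟩
    (m % N * (n % N)) % N  ≡⟨ cong (λ r → (m % N * r) % N) eq ⟩
    (m % N * (n′ % N)) % N ≡⟨ %-distribˡ-* m n′ N ⟨
    (m * n′) % N           ∎

  %-cong-*ˡ : ∀ {m m′} n → m % N ≡ m′ % N → (m * n) % N ≡ (m′ * n) % N
  %-cong-*ˡ {m} {m′} n eq = begin
    (m * n) % N   ≡⟨ cong (_% N) (*-comm m n) ⟩
    (n * m) % N   ≡⟨ %-cong-*ʳ n eq ⟩
    (n * m′) % N  ≡⟨ cong (_% N) (*-comm n m′) ⟩
    (m′ * n) % N  ∎

module _ {N : ℕ} where

  restrict : {f : ℕ → ℕ} → (∀ k → f k < N) → Fin N → Fin N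
  restrict f<N x = fromℕ< (f<N (toℕ x))

  toℕ-restrict : {f : ℕ → ℕ} (f<N : ∀ k → f k < N) (x : Fin N) →
                 toℕ (restrict f<N x) ≡ f (toℕ x)
  toℕ-restrict f<N x = toℕ-fromℕ< (f<N (toℕ x))

  restrict-inverse : {f g : ℕ → ℕ} (f<N : ∀ k → f k < N) (g<N : ∀ k → g k < N) →
                     (∀ {j} → j < N → f (g j) ≡ j) →
                     ∀ x → restrict f<N (restrict g<N x) ≡ x
  restrict-inverse {f} {g} f<N g<N f∘g x = toℕ-injective (begin
    toℕ (restrict f<N (restrict g<N x)) ≡⟨ toℕ-restrict f<N _ ⟩
    f (toℕ (restrict g<N x))            ≡⟨ cong f (toℕ-restrict g<N x) ⟩
    f (g (toℕ x))                       ≡⟨ f∘g (toℕ<n x) ⟩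
    toℕ x                               ∎)

module Halving (N : ℕ) .{{_ : NonZero N}} (h c : ℕ) (2h≡1+N : 2 * h ≡ suc N) where

  halve : ℕ → ℕ
  halve k = ((c + k) * h) % N

  halve<N : ∀ k → halve k < N
  halve<N k = m%n<n _ N

  2*[x*h]≡x : ∀ x → (2 * (x * h)) % N ≡ x % N
  2*[x*h]≡x x = begin
    (2 * (x * h)) % N ≡⟨ cong (_% N) (2*[x*y]≡x*[2*y] x h) ⟩
    (x * (2 * h)) % N ≡⟨ cong (λ y → (x * y) % N) 2h≡1+N ⟩
    (x * suc N) % N   ≡⟨ cong (_% N) (*-suc x N) ⟩
    (x + x * N) % N   ≡⟨ [m+kn]%n≡m%n x x N ⟩
    x % N             ∎
    where
    2*[x*y]≡x*[2*y] : ∀ x y → 2 * (x * y) ≡ x * (2 * y)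
    2*[x*y]≡x*[2*y] = solve-∀

  2*halve≡c+k : ∀ k → (2 * halve k) % N ≡ (c + k) % N
  2*halve≡c+k k = trans (%-cong-*ʳ 2 (m%n%n≡m%n _ N)) (2*[x*h]≡x (c + k))

  halve-unique : ∀ {k p} → (2 * p) % N ≡ (c + k) % N → p < N → halve k ≡ p
  halve-unique {k} {p} 2p≡c+k p<N = begin
    ((c + k) * h) % N ≡⟨ %-cong-*ˡ h (sym 2p≡c+k) ⟩
    (2 * p * h) % N   ≡⟨ cong (_% N) (*-assoc 2 p h) ⟩
    (2 * (p * h)) % N ≡⟨ 2*[x*h]≡x p ⟩
    p % N             ≡⟨ m<n⇒m%n≡m p<N ⟩
    p                 ∎

  halve-≡0 : ∀ {k} → c + k ≡ N → halve k ≡ 0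
  halve-≡0 {k} c+k≡N = begin
    ((c + k) * h) % N ≡⟨ cong (λ y → (y * h) % N) c+k≡N ⟩
    (N * h) % N       ≡⟨ cong (_% N) (*-comm N h) ⟩
    (h * N) % N       ≡⟨ m*n%n≡0 h N ⟩
    0                 ∎

  2*suc-halve≡c+2+k : ∀ k → (2 * suc (halve k)) % N ≡ (c + (2 + k)) % N
  2*suc-halve≡c+2+k k = begin
    (2 * suc (halve k)) % N ≡⟨ cong (_% N) (*-suc 2 (halve k)) ⟩
    (2 + 2 * halve k) % N   ≡⟨ %-cong-+ʳ 2 (2*halve≡c+k k) ⟩
    (2 + (c + k)) % N       ≡⟨ cong (_% N) (2+[c+k]≡c+[2+k] c k) ⟩
    (c + (2 + k)) % N       ∎
    where
    2+[c+k]≡c+[2+k] : ∀ c k → 2 + (c + k) ≡ c + (2 + k)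
    2+[c+k]≡c+[2+k] = solve-∀

  halve-2+ : ∀ k → halve (2 + k) ≡ suc (halve k) ⊎ halve (2 + k) ≡ 0
  halve-2+ k with m≤n⇒m<n∨m≡n (halve<N k)
  ... | inj₁ 1+σ<N = inj₁ (halve-unique (2*suc-halve≡c+2+k k) 1+σ<N)
  ... | inj₂ 1+σ≡N = inj₂ (halve-unique 2*0≡c+2+k (>-nonZero⁻¹ N))
    where
    2*0≡c+2+k : (2 * 0) % N ≡ (c + (2 + k)) % N
    2*0≡c+2+k = begin
      0 % N                   ≡⟨ m<n⇒m%n≡m (>-nonZero⁻¹ N) ⟩
      0                       ≡⟨ m*n%n≡0 2 N ⟨
      (2 * N) % N             ≡⟨ cong (λ y → (2 * y) % N) 1+σ≡N ⟨
      (2 * suc (halve k)) % N ≡⟨ 2*suc-halve≡c+2+k k ⟩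
      (c + (2 + k)) % N       ∎

  -- c * pred N stands for −c modulo N.
  double : ℕ → ℕ
  double j = (c * pred N + 2 * j) % N

  double<N : ∀ j → double j < N
  double<N j = m%n<n _ N

  c*pred+c≡c*N : c * pred N + c ≡ c * N
  c*pred+c≡c*N = begin
    c * pred N + c      ≡⟨ +-comm (c * pred N) c ⟩
    c + c * pred N      ≡⟨ *-suc c (pred N) ⟨
    c * suc (pred N)    ≡⟨ cong (c *_) (suc-pred N) ⟩
    c * N               ∎

  double-halve : ∀ {k} → k < N → double (halve k) ≡ k
  double-halve {k} k<N = begin
    (c * pred N + 2 * halve k) % N ≡⟨ %-cong-+ʳ (c * pred N) (2*halve≡c+k k) ⟩
    (c * pred N + (c + k)) % N     ≡⟨ cong (_% N) (+-assoc (c * pred N) c k) ⟨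
    (c * pred N + c + k) % N       ≡⟨ cong (λ y → (y + k) % N) c*pred+c≡c*N ⟩
    (c * N + k) % N                ≡⟨ cong (_% N) (+-comm (c * N) k) ⟩
    (k + c * N) % N                ≡⟨ [m+kn]%n≡m%n k c N ⟩
    k % N                          ≡⟨ m<n⇒m%n≡m k<N ⟩
    k                              ∎

  halve-double : ∀ {j} → j < N → halve (double j) ≡ j
  halve-double {j} j<N = halve-unique (sym (begin
    (c + double j) % N                 ≡⟨ %-cong-+ʳ c (m%n%n≡m%n _ N) ⟩
    (c + (c * pred N + 2 * j)) % N     ≡⟨ cong (_% N) (+-assoc c (c * pred N) (2 * j)) ⟨
    (c + c * pred N + 2 * j) % N       ≡⟨ cong (λ y → (y + 2 * j) % N) (+-comm c (c * pred N)) ⟩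
    (c * pred N + c + 2 * j) % N       ≡⟨ cong (λ y → (y + 2 * j) % N) c*pred+c≡c*N ⟩
    (c * N + 2 * j) % N                ≡⟨ cong (_% N) (+-comm (c * N) (2 * j)) ⟩
    (2 * j + c * N) % N                ≡⟨ [m+kn]%n≡m%n (2 * j) c N ⟩
    (2 * j) % N                        ∎)) j<N

  halve-⤖ : Fin N ⤖ Fin N
  halve-⤖ = ↔⇒⤖ (mk↔ₛ′ (restrict halve<N) (restrict double<N)
    (restrict-inverse halve<N double<N halve-double)
    (restrict-inverse double<N halve<N double-halve))

  toℕ-halve-⤖ : ∀ x → toℕ (Bijection.to halve-⤖ x) ≡ halve (toℕ x)
  toℕ-halve-⤖ = toℕ-restrict halve<N

  coprime-labels-two-apart : ∀ k → Coprime (suc (halve k)) (suc (halve (2 + k)))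
  coprime-labels-two-apart k with halve-2+ k
  ... | inj₁ σ[2+k]≡1+σ[k] =
    subst (Coprime (suc (halve k)) ∘ suc) (sym σ[2+k]≡1+σ[k]) (coprime-suc (suc (halve k)))
  ... | inj₂ σ[2+k]≡0 =
    subst (Coprime (suc (halve k)) ∘ suc) (sym σ[2+k]≡0) (Coprime-sym (1-coprimeTo (suc (halve k))))

coprime-neighbours⇒NbhdGcdOne : ∀ (G : Graph) (ℓ : Fin (N G) → ℕ) v a b →
  Adj G v a → Adj G v b → Coprime (ℓ a) (ℓ b) → NbhdGcdOne G ℓ v
coprime-neighbours⇒NbhdGcdOne G ℓ v a b v~a v~b coprime d d∣ℓ =
  coprime (d∣ℓ a v~a , d∣ℓ b v~b)

data Position : ℕ → Set where
  at-u : ∀ i → Position (4 * i)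
  at-v : ∀ i → Position (4 * i + 1)
  at-w : ∀ i → Position (4 * i + 2)
  at-x : ∀ i → Position (4 * i + 3)

4i+1≡1+4i : ∀ i → 4 * i + 1 ≡ suc (4 * i)
4i+1≡1+4i i = +-comm (4 * i) 1

4i+2≡1+[4i+1] : ∀ i → 4 * i + 2 ≡ suc (4 * i + 1)
4i+2≡1+[4i+1] i = +-suc (4 * i) 1

4i+3≡1+[4i+2] : ∀ i → 4 * i + 3 ≡ suc (4 * i + 2)
4i+3≡1+[4i+2] i = +-suc (4 * i) 2

4[1+i]≡1+[4i+3] : ∀ i → 4 * suc i ≡ suc (4 * i + 3)
4[1+i]≡1+[4i+3] = solve-∀

position : ∀ k → Position k
position zero = at-u 0
position (suc k) with position k
... | at-u i = subst Position (4i+1≡1+4i i) (at-v i)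
... | at-v i = subst Position (4i+2≡1+[4i+1] i) (at-w i)
... | at-w i = subst Position (4i+3≡1+[4i+2] i) (at-x i)
... | at-x i = subst Position (4[1+i]≡1+[4i+3] i) (at-u (suc i))

4i≤k⇒1+i<n : ∀ {i k n} → 4 * i ≤ k → 4 + k < 4 * n → suc i < n
4i≤k⇒1+i<n {i} {k} {n} 4i≤k 4+k<4n = *-cancelˡ-< 4 (suc i) n
  (subst (_< 4 * n) (sym (*-suc 4 i)) (≤-<-trans (+-monoʳ-≤ 4 4i≤k) 4+k<4n))

edge-to-successor : ∀ {n} k → 4 + k < 4 * n → SnakeEdge n k (suc k)
edge-to-successor {n} k 4+k<4n with position k
... | at-u i = subst (SnakeEdge n _) (4i+1≡1+4i i) (u-v i (4i≤k⇒1+i<n ≤-refl 4+k<4n))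
... | at-v i = subst (SnakeEdge n _) (4i+2≡1+[4i+1] i) (v-w i (4i≤k⇒1+i<n (m≤m+n _ 1) 4+k<4n))
... | at-w i = subst (SnakeEdge n _) (4i+3≡1+[4i+2] i) (w-x i (4i≤k⇒1+i<n (m≤m+n _ 2) 4+k<4n))
... | at-x i = subst (SnakeEdge n _) (4[1+i]≡1+[4i+3] i) (x-u i (4i≤k⇒1+i<n (m≤m+n _ 3) 4+k<4n))

module PentagonalSnake (m : ℕ) where

  n : ℕ
  n = 2 + m

  order : ℕ
  order = 4 * n ∸ 3

  order≡5+4m : order ≡ 5 + 4 * m
  order≡5+4m = cong (_∸ 3) (*-distribˡ-+ 4 2 m)

  <5+4m⇒<order : ∀ {k} → k < 5 + 4 * m → k < order
  <5+4m⇒<order {k} = subst (k <_) (sym order≡5+4m)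

  instance
    order-nonZero : NonZero order
    order-nonZero = >-nonZero (<5+4m⇒<order z<s)

  2*[3+2m]≡1+order : 2 * (3 + 2 * m) ≡ suc order
  2*[3+2m]≡1+order = trans (2*[3+2m]≡6+4m m) (cong suc (sym order≡5+4m))
    where
    2*[3+2m]≡6+4m : ∀ m → 2 * (3 + 2 * m) ≡ 6 + 4 * m
    2*[3+2m]≡6+4m = solve-∀

  open Halving order (3 + 2 * m) 2 2*[3+2m]≡1+order

  path-edge : ∀ {k} → suc k < order → SnakeEdge n k (suc k)
  path-edge {k} 1+k<order = edge-to-successor k (subst (4 + k <_) (sym (*-distribˡ-+ 4 2 m))
    (+-monoʳ-< 3 (subst (suc k <_) order≡5+4m 1+k<order)))

  halve-4 : halve 4 ≡ 3
  halve-4 = halve-unique refl (<5+4m⇒<order (s≤s (s≤s (s≤s (s≤s z≤n)))))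

  halve-1 : halve 1 ≡ 2 * n
  halve-1 = halve-unique 2*2n≡3
    (<5+4m⇒<order (subst (2 * n <_) (1+2n+2m≡5+4m m) (m≤m+n _ (2 * m))))
    where
    2*2n≡3+5+4m : ∀ m → 2 * (2 * (2 + m)) ≡ 3 + (5 + 4 * m)
    2*2n≡3+5+4m = solve-∀

    1+2n+2m≡5+4m : ∀ m → suc (2 * (2 + m)) + 2 * m ≡ 5 + 4 * m
    1+2n+2m≡5+4m = solve-∀

    2*2n≡3 : (2 * (2 * n)) % order ≡ 3 % order
    2*2n≡3 = trans (cong (_% order) (trans (2*2n≡3+5+4m m) (cong (3 +_) (sym order≡5+4m))))
                   ([m+n]%n≡m%n 3 order)

  snake : Graph
  snake = pentagonalSnake n

  ℓ : Fin order → ℕ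
  ℓ = label halve-⤖

  ℓ-fromℕ< : ∀ {k} (k<order : k < order) → ℓ (fromℕ< k<order) ≡ suc (halve k)
  ℓ-fromℕ< k<order =
    cong suc (trans (toℕ-halve-⤖ (fromℕ< k<order)) (cong halve (toℕ-fromℕ< k<order)))

  _~_ : ℕ → ℕ → Set
  k ~ a = SnakeEdge n k a ⊎ SnakeEdge n a k

  coprime-neighbours : ∀ v {k a b} → toℕ v ≡ k → (a<order : a < order) (b<order : b < order) →
    k ~ a → k ~ b → Coprime (suc (halve a)) (suc (halve b)) → NbhdGcdOne snake ℓ v
  coprime-neighbours v refl a<order b<order v~a v~b coprime =
    coprime-neighbours⇒NbhdGcdOne snake ℓ v (fromℕ< a<order) (fromℕ< b<order)
      (subst (toℕ v ~_) (sym (toℕ-fromℕ< a<order)) v~a)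
      (subst (toℕ v ~_) (sym (toℕ-fromℕ< b<order)) v~b)
      (subst₂ Coprime (sym (ℓ-fromℕ< a<order)) (sym (ℓ-fromℕ< b<order)) coprime)

  nbhdGcdOne : ∀ v → NbhdGcdOne snake ℓ v
  nbhdGcdOne v = at (toℕ v) refl (toℕ<n v)
    where
    at : ∀ k → toℕ v ≡ k → k < order → NbhdGcdOne snake ℓ v
    at zero v≡0 _ = coprime-neighbours v v≡0 1<order 4<order
      (inj₁ (path-edge 1<order)) (inj₁ (u-u 0 (s≤s (s≤s z≤n))))
      (subst₂ Coprime (cong suc (sym halve-1)) (cong suc (sym halve-4)) (odd-coprime-4 n))
      where
      1<order = <5+4m⇒<order (s≤s (s≤s z≤n))
      4<order = <5+4m⇒<order (s≤s (s≤s (s≤s (s≤s (s≤s z≤n)))))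
    at (suc j) v≡1+j 1+j<order with m≤n⇒m<n∨m≡n 1+j<order
    ... | inj₁ 2+j<order = coprime-neighbours v v≡1+j (<-trans (n<1+n j) 1+j<order) 2+j<order
      (inj₂ (path-edge 1+j<order)) (inj₁ (path-edge 2+j<order)) (coprime-labels-two-apart j)
    ... | inj₂ 2+j≡order = coprime-neighbours v v≡1+j j<order j<order
      (inj₂ (path-edge 1+j<order)) (inj₂ (path-edge 1+j<order))
      (subst (λ σ → Coprime (suc σ) (suc σ)) (sym (halve-≡0 2+j≡order)) (1-coprimeTo 1))
      where
      j<order = <-trans (n<1+n j) 1+j<order

  neighborhoodPrime : NeighborhoodPrime snake
  neighborhoodPrime = halve-⤖ , λ v _ → nbhdGcdOne v

mainTheorem4 : ∀ (n : ℕ) → 2 ≤ n → NeighborhoodPrime (pentagonalSnake n)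
mainTheorem4 (suc (suc m)) _ = PentagonalSnake.neighborhoodPrime m
mainTheorem4 (suc zero) (s≤s ())
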